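{- Let $\alpha=[\alpha_1,\ldots,\alpha_k]$ be a composition of $n$ such that $n\le 1$ or $\alpha_1>1$. Then $\theta_\alpha=\theta^{BH}_\alpha$.
   Context: A composition $\alpha=[\alpha_1,\ldots,\alpha_k]$ of $n$ ($\alpha\vDash n$) is an ordered list of positive integers summing to $n$; $k(\alpha)=k$; $I(\alpha)=\{\alpha_1,\alpha_1+\alpha_2,\ldots,\alpha_1+\cdots+\alpha_{k-1}\}\subset[n-1]$; $A+1=\{a+1:a\in A\}$. $M_\alpha=\sum_{i_1<\cdots<i_k}x_{i_1}^{\alpha_1}\cdots x_{i_k}^{\alpha_k}$ (indices ranging over $\mathbb{N}$). Define $\theta_\alpha=\sum_{\beta\vDash n,\ I(\alpha)\subset I(\beta)\cup(I(\beta)+1)}2^{k(\beta)}M_\beta$. Let $\mathcal{A}(I(\alpha))$ be the set of weakly increasing sequences $J=(j_1\le j_2\le\cdots\le j_n)$ in $\mathbb{N}$ such that there is no $i\in I(\alpha)$ with $j_{i-1}=j_i=j_{i+1}$. Define \[\theta^{BH}_\alpha=\sum_{J\in\mathcal{A}(I(\alpha))}2^{|J|}x_{j_1}\cdots x_{j_n},\] where $|J|$ is the number of distinct values among $j_1,\ldots,j_n$. -}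

module Defs where

open import Data.Nat using (ℕ; zero; suc; _+_; _*_; _^_; _≡ᵇ_; _≤ᵇ_; _<ᵇ_)
open import Data.Bool using (Bool; true; false; _∧_; _∨_; not; if_then_else_)
open import Data.Maybe using (Maybe; just; nothing)
open import Data.Product using (_×_; _,_)
open import Data.List using (List; []; _∷_; map; length; filterᵇ; concatMap; upTo; zip; deduplicateᵇ; foldr)
open import Data.Nat.ListAction using (sum)
open import Data.Bool.ListAction using (any; all)

-- Conventions.
-- * A composition is a list of positive naturals (hypotheses in the statement).
-- * Variables x_j are indexed by j ∈ ℕ (starting at 0; irrelevant by symmetry).
-- * A monomial x^e is represented by its exponent vector e : List ℕ
--   (e_j = exponent of x_j; missing/trailing entries are 0).  Two exponent
--   vectors denote the same monomial iff they agree after stripping trailing 0s.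
-- * A (homogeneous, ℕ-coefficient) formal power series is given by its
--   coefficient function List ℕ → ℕ; equality of series is equality of all
--   coefficients.

I : List ℕ → List ℕ
I [] = []
I (a ∷ []) = []
I (a ∷ b ∷ r) = a ∷ map (a +_) (I (b ∷ r))

memb : ℕ → List ℕ → Bool
memb i xs = any (λ j → i ≡ᵇ j) xs

containCond : List ℕ → List ℕ → Bool
containCond α β = all (λ i → memb i (I β) ∨ memb i (map suc (I β))) (I α)

compositions : ℕ → List (List ℕ)
compositions zero = [] ∷ []
compositions (suc zero) = (1 ∷ []) ∷ []
compositions (suc (suc n)) =
  concatMap (λ c → (1 ∷ c) ∷ incrHead c ∷ []) (compositions (suc n))
  where
  incrHead : List ℕ → List ℕ
  incrHead [] = []
  incrHead (a ∷ r) = suc a ∷ r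

addAt : ℕ → ℕ → List ℕ → List ℕ
addAt zero c [] = c ∷ []
addAt zero c (x ∷ v) = (x + c) ∷ v
addAt (suc i) c [] = 0 ∷ addAt i c []
addAt (suc i) c (x ∷ v) = x ∷ addAt i c v

monoOf : List (ℕ × ℕ) → List ℕ
monoOf = foldr (λ { (i , c) v → addAt i c v }) []

monoOfIdx : List ℕ → List ℕ
monoOfIdx J = monoOf (map (λ j → j , 1) J)

stripZ : List ℕ → List ℕ
stripZ [] = []
stripZ (x ∷ v) = cons' x (stripZ v)
  where
  cons' : ℕ → List ℕ → List ℕ
  cons' zero [] = []
  cons' y r = y ∷ r

eqList : List ℕ → List ℕ → Bool
eqList [] [] = true
eqList [] (_ ∷ _) = false
eqList (_ ∷ _) [] = false
eqList (x ∷ xs) (y ∷ ys) = (x ≡ᵇ y) ∧ eqList xs ys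

sameMono : List ℕ → List ℕ → Bool
sameMono e f = eqList (stripZ e) (stripZ f)

allSeqs : ℕ → ℕ → List (List ℕ)
allSeqs zero L = [] ∷ []
allSeqs (suc n) L = concatMap (λ j → map (j ∷_) (allSeqs n L)) (upTo L)

weakInc : List ℕ → Bool
weakInc [] = true
weakInc (x ∷ []) = true
weakInc (x ∷ y ∷ r) = (x ≤ᵇ y) ∧ weakInc (y ∷ r)

strictInc : List ℕ → Bool
strictInc [] = true
strictInc (x ∷ []) = true
strictInc (x ∷ y ∷ r) = (x <ᵇ y) ∧ strictInc (y ∷ r)

-- Coefficient of x^e in M_β = Σ_{i₁<⋯<i_k} x_{i₁}^{β₁}⋯x_{i_k}^{β_k}.
-- Only indices < length e can contribute, so the enumeration is bounded by it.
coeffM : List ℕ → List ℕ → ℕ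
coeffM β e = length (filterᵇ (λ is → sameMono (monoOf (zip is β)) e)
                     (filterᵇ strictInc (allSeqs (length β) (length e))))

-- Coefficient of x^e in θ_α = Σ_{β ⊨ n, I(α) ⊆ I(β) ∪ (I(β)+1)} 2^{k(β)} M_β
coeffθ : ℕ → List ℕ → List ℕ → ℕ
coeffθ n α e = sum (map (λ β → if containCond α β then 2 ^ length β * coeffM β e else 0)
                        (compositions n))

nth : List ℕ → ℕ → Maybe ℕ
nth [] _ = nothing
nth (x ∷ _) zero = just x
nth (_ ∷ xs) (suc i) = nth xs i

eq3 : Maybe ℕ → Maybe ℕ → Maybe ℕ → Bool
eq3 (just a) (just b) (just c) = (a ≡ᵇ b) ∧ (b ≡ᵇ c)
eq3 _ _ _ = false

-- j_{i-1} = j_i = j_{i+1} (1-based positions; false if a position does not exist)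
triple : List ℕ → ℕ → Bool
triple J zero = false
triple J (suc zero) = false
triple J (suc (suc m)) = eq3 (nth J m) (nth J (suc m)) (nth J (suc (suc m)))

-- J ∈ 𝒜(I(α)) (for J weakly increasing)
inA : List ℕ → List ℕ → Bool
inA α J = not (any (triple J) (I α))

distinct : List ℕ → ℕ
distinct J = length (deduplicateᵇ _≡ᵇ_ J)

-- Coefficient of x^e in θ^BH_α = Σ_{J ∈ 𝒜(I(α))} 2^{|J|} x_{j₁}⋯x_{j_n}
coeffBH : ℕ → List ℕ → List ℕ → ℕ
coeffBH n α e = sum (map (λ J → if inA α J ∧ sameMono (monoOfIdx J) e then 2 ^ distinct J else 0)
                         (filterᵇ weakInc (allSeqs n (length e))))

{-# OPTIONS --safe #-}
-- Fix a monomial x^e and compare coefficients.  x^e occurs in M_β (with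
-- coefficient 1) iff β is shape e, the composition of the nonzero exponents
-- of e; so its coefficient in θ_α is 2^k(shape e) if |e| = n and
-- I(α) ⊆ I(shape e) ∪ (I(shape e)+1), and 0 otherwise.  On the other side, the
-- only weakly increasing J with x_J = x^e is indexSeq e, which repeats each
-- variable index as often as its exponent; it has k(shape e) distinct values,
-- and j_t ≠ j_{t+1} exactly for t ∈ I(shape e).  Hence j_{i-1} = j_i = j_{i+1}
-- fails iff i ∈ I(shape e) ∪ (I(shape e)+1), as long as 1 < i < n; the
-- hypothesis on α ensures this for every i ∈ I(α).
module Submission where

open import Defs
import Algebra.Lattice.Properties.BooleanAlgebra as BooleanAlgebraProperties
open import Data.Bool using (Bool; true; false; T; T?; _∧_; _∨_; not; if_then_else_)
open import Data.Bool.ListAction using (any; all)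
open import Data.Bool.Properties
  using (T-≡; T-∧; ∧-identityʳ; ∧-zeroʳ; ∨-comm; not-involutive; ∨-∧-booleanAlgebra)
open import Data.List
  using (List; []; _∷_; _++_; map; length; filter; filterᵇ; concatMap; upTo; applyUpTo;
         replicate; zip; unzip; deduplicateᵇ)
open import Data.List.Membership.Propositional using (_∈_)
open import Data.List.Membership.Propositional.Properties using (∈-filter⁻)
open import Data.List.Properties
  using (≡-dec; filter-++; filter-none; filter-all; filter-idem; length-++; length-replicate;
         map-applyUpTo; map-∘; concatMap-cong; unzip-zip; zip-unzip; length-unzipWith₁; length-unzipWith₂)
open import Data.List.Relation.Unary.All as All using (All; []; _∷_)
open import Data.List.Relation.Unary.All.Properties
  using (map⁺; ++⁺; concat⁺; replicate⁺; applyUpTo⁺₂; deduplicate⁺)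
open import Data.List.Relation.Unary.Any using (here; there)
open import Data.Nat using (ℕ; zero; suc; _+_; _*_; _^_; _<_; _≤_; _≟_; s≤s; z≤n; _≡ᵇ_)
open import Data.Nat.ListAction using (sum)
open import Data.Nat.Properties
  using (≤-refl; ≤-trans; <-trans; <⇒≤; <⇒≢; n≤1+n; n<1+n; m≤m+n; m<m+n; 1+n≰n;
         +-identityʳ; +-suc; +-comm; +-assoc; +-mono-≤; +-monoʳ-<; *-identityˡ; *-identityʳ; *-zeroʳ;
         ≡ᵇ⇒≡; ≡⇒≡ᵇ; <ᵇ⇒<; <⇒<ᵇ; ≤ᵇ⇒≤; ≤⇒≤ᵇ)
open import Data.Product using (Σ; _×_; _,_; proj₁; proj₂)
open import Data.Sum using (_⊎_; inj₁; inj₂)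
open import Function using (_∘_; id)
open import Function.Bundles using (module Equivalence)
open import Relation.Binary.Definitions using (DecidableEquality)
open import Relation.Binary.PropositionalEquality
  using (module ≡-Reasoning; _≡_; _≢_; refl; sym; trans; cong; cong₂; subst)
open import Relation.Nullary using (¬_; ¬?; yes; no; does; contradiction)
open import Relation.Nullary.Decidable using (dec-true; dec-false)
open import Relation.Unary using (Pred; Decidable)

open BooleanAlgebraProperties ∨-∧-booleanAlgebra using (deMorgan₂)
open Equivalence using (to; from)

≡ᵇ-refl : ∀ m → (m ≡ᵇ m) ≡ true
≡ᵇ-refl m = dec-true (m ≟ m) refl

≢⇒≡ᵇ-false : ∀ {m n} → m ≢ n → (m ≡ᵇ n) ≡ false
≢⇒≡ᵇ-false {m} {n} = dec-false (m ≟ n)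

eqList⇒≡ : ∀ xs ys → T (eqList xs ys) → xs ≡ ys
eqList⇒≡ []       []       _ = refl
eqList⇒≡ (x ∷ xs) (y ∷ ys) p =
  let x≡ᵇy , same-tail = to T-∧ p in cong₂ _∷_ (≡ᵇ⇒≡ x y x≡ᵇy) (eqList⇒≡ xs ys same-tail)

eqList-refl : ∀ xs → T (eqList xs xs)
eqList-refl []       = _
eqList-refl (x ∷ xs) = from T-∧ (≡⇒≡ᵇ x x refl , eqList-refl xs)

∧-cong-T : ∀ b {x y} → (T b → x ≡ y) → b ∧ x ≡ b ∧ y
∧-cong-T true  x≡y = x≡y _
∧-cong-T false _   = refl

indicator-* : ∀ b c m → (if b then 1 else 0) * (if c then m else 0) ≡ (if b ∧ c then m else 0)
indicator-* true  c m = *-identityˡ _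
indicator-* false c m = refl

not-any : ∀ {P : ℕ → Set} {p q : ℕ → Bool} {xs} → All P xs → (∀ {x} → P x → not (p x) ≡ q x) →
          not (any p xs) ≡ all q xs
not-any []                            _       = refl
not-any {p = p} {xs = x ∷ xs} (px ∷ pxs) not-p≡q =
  trans (deMorgan₂ (p x) (any p xs)) (cong₂ _∧_ (not-p≡q px) (not-any pxs not-p≡q))

strictInc⁻ : ∀ {i is} → T (strictInc (i ∷ is)) → All (i <_) is × T (strictInc is)
strictInc⁻ {i} {[]}     _      = [] , _
strictInc⁻ {i} {j ∷ is} sorted =
  let i<ᵇj , sorted-tail = to T-∧ sorted
      i<j = <ᵇ⇒< i j i<ᵇj
  in (i<j ∷ All.map (<-trans i<j) (proj₁ (strictInc⁻ sorted-tail))) , sorted-tail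

weakInc⁻ : ∀ {i is} → T (weakInc (i ∷ is)) → All (i ≤_) is × T (weakInc is)
weakInc⁻ {i} {[]}     _      = [] , _
weakInc⁻ {i} {j ∷ is} sorted =
  let i≤ᵇj , sorted-tail = to T-∧ sorted
      i≤j = ≤ᵇ⇒≤ i j i≤ᵇj
  in (i≤j ∷ All.map (≤-trans i≤j) (proj₁ (weakInc⁻ sorted-tail))) , sorted-tail

weakInc-∷ : ∀ {i is} → All (i ≤_) is → T (weakInc is) → T (weakInc (i ∷ is))
weakInc-∷ []        _      = _
weakInc-∷ (i≤j ∷ _) sorted = from T-∧ (≤⇒≤ᵇ i≤j , sorted)

occurrences : {A : Set} → DecidableEquality A → A → List A → ℕ
occurrences _≟_ y = length ∘ filter (y ≟_)

module _ {A : Set} (_≟_ : DecidableEquality A) where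

  occurrences-++ : ∀ y xs ys → occurrences _≟_ y (xs ++ ys) ≡ occurrences _≟_ y xs + occurrences _≟_ y ys
  occurrences-++ y xs ys = trans (cong length (filter-++ (y ≟_) xs ys)) (length-++ (filter (y ≟_) xs))

  occurrences-none : ∀ {y xs} → All (y ≢_) xs → occurrences _≟_ y xs ≡ 0
  occurrences-none {y} y∉xs = cong length (filter-none (y ≟_) y∉xs)

  sum-map-concentrated : ∀ (f : A → ℕ) y xs → (∀ {x} → x ∈ xs → x ≢ y → f x ≡ 0) →
                         sum (map f xs) ≡ occurrences _≟_ y xs * f y
  sum-map-concentrated f y []       _      = refl
  sum-map-concentrated f y (x ∷ xs) vanish with y ≟ x
  ... | yes refl = cong (f y +_) (sum-map-concentrated f y xs (vanish ∘ there))
  ... | no  y≢x  = cong₂ _+_ (vanish (here refl) (y≢x ∘ sym)) (sum-map-concentrated f y xs (vanish ∘ there))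

  length-filter-concentrated : ∀ {p} {P : Pred A p} (P? : Decidable P) {y} xs →
                               (∀ {x} → x ∈ xs → P x → x ≡ y) → P y →
                               length (filter P? xs) ≡ occurrences _≟_ y xs
  length-filter-concentrated P?     []       _      _  = refl
  length-filter-concentrated P? {y} (x ∷ xs) unique py with P? x | y ≟ x
  ... | yes _   | yes refl = cong suc (length-filter-concentrated P? xs (unique ∘ there) py)
  ... | yes px  | no  y≢x  = contradiction (sym (unique (here refl) px)) y≢x
  ... | no  ¬px | yes refl = contradiction py ¬px
  ... | no  _   | no  _    = length-filter-concentrated P? xs (unique ∘ there) py

  occurrences-filter : ∀ {p} {P : Pred A p} (P? : Decidable P) {y} xs → P y →
                       occurrences _≟_ y (filter P? xs) ≡ occurrences _≟_ y xs
  occurrences-filter P?     []       _  = refl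
  occurrences-filter P? {y} (x ∷ xs) py with P? x
  ... | yes _ with y ≟ x
  ...   | yes _ = cong suc (occurrences-filter P? xs py)
  ...   | no  _ = occurrences-filter P? xs py
  occurrences-filter P? {y} (x ∷ xs) py | no ¬px with y ≟ x
  ...   | yes refl = contradiction py ¬px
  ...   | no  _    = occurrences-filter P? xs py

module _ {A : Set} (_≟_ : DecidableEquality A) where

  private
    _≟ₗ_ : DecidableEquality (List A)
    _≟ₗ_ = ≡-dec _≟_

  occurrences-map-∷ : ∀ y ys x X →
    occurrences _≟ₗ_ (y ∷ ys) (map (x ∷_) X) ≡ (if does (y ≟ x) then occurrences _≟ₗ_ ys X else 0)
  occurrences-map-∷ y ys x [] with y ≟ x
  ... | yes _ = refl
  ... | no  _ = refl
  occurrences-map-∷ y ys x (z ∷ X) with y ≟ x | ys ≟ₗ z | occurrences-map-∷ y ys x X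
  ... | yes _ | yes _ | ih = cong suc ih
  ... | yes _ | no  _ | ih = ih
  ... | no  _ | _     | ih = ih

  occurrences-cartesian : ∀ y ys X xs →
    occurrences _≟ₗ_ (y ∷ ys) (concatMap (λ x → map (x ∷_) X) xs)
      ≡ occurrences _≟_ y xs * occurrences _≟ₗ_ ys X
  occurrences-cartesian y ys X [] = refl
  occurrences-cartesian y ys X (x ∷ xs)
    rewrite occurrences-++ _≟ₗ_ (y ∷ ys) (map (x ∷_) X) (concatMap (λ x → map (x ∷_) X) xs)
          | occurrences-map-∷ y ys x X
          | occurrences-cartesian y ys X xs
    with y ≟ x
  ... | yes _ = refl
  ... | no  _ = refl

-- Both decisions compute to y ≡ᵇ x.
occurrences-map-suc : ∀ y xs → occurrences _≟_ (suc y) (map suc xs) ≡ occurrences _≟_ y xs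
occurrences-map-suc y []       = refl
occurrences-map-suc y (x ∷ xs) with y ≡ᵇ x
... | true  = cong suc (occurrences-map-suc y xs)
... | false = occurrences-map-suc y xs

occurrences-upTo : ∀ {y L} → y < L → occurrences _≟_ y (upTo L) ≡ 1
occurrences-upTo {zero}  {suc L} _          = cong suc (occurrences-none _≟_ (applyUpTo⁺₂ suc L (λ _ ())))
occurrences-upTo {suc y} {suc L} (s≤s y<L) = begin
  occurrences _≟_ (suc y) (applyUpTo suc L)   ≡⟨ cong (occurrences _≟_ (suc y)) (map-applyUpTo id suc L) ⟨
  occurrences _≟_ (suc y) (map suc (upTo L))  ≡⟨ occurrences-map-suc y (upTo L) ⟩
  occurrences _≟_ y (upTo L)                  ≡⟨ occurrences-upTo y<L ⟩
  1                                           ∎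
  where open ≡-Reasoning

_≟ₗ_ : DecidableEquality (List ℕ)
_≟ₗ_ = ≡-dec _≟_

allSeqs-length : ∀ n L → All (λ xs → length xs ≡ n) (allSeqs n L)
allSeqs-length zero    L = refl ∷ []
allSeqs-length (suc n) L =
  concat⁺ (map⁺ (applyUpTo⁺₂ _ L (λ _ → map⁺ (All.map (cong suc) (allSeqs-length n L)))))

occurrences-allSeqs : ∀ n {L} ys → All (_< L) ys →
                      occurrences _≟ₗ_ ys (allSeqs n L) ≡ (if length ys ≡ᵇ n then 1 else 0)
occurrences-allSeqs zero        []       _ = refl
occurrences-allSeqs zero        (_ ∷ _)  _ = refl
occurrences-allSeqs (suc n) {L} []       _ = occurrences-none _≟ₗ_ (All.map (λ { () refl }) (allSeqs-length (suc n) L))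
occurrences-allSeqs (suc n) {L} (y ∷ ys) (y<L ∷ ys<L) = begin
  occurrences _≟ₗ_ (y ∷ ys) (allSeqs (suc n) L)
    ≡⟨ occurrences-cartesian _≟_ y ys (allSeqs n L) (upTo L) ⟩
  occurrences _≟_ y (upTo L) * occurrences _≟ₗ_ ys (allSeqs n L)
    ≡⟨ cong₂ _*_ (occurrences-upTo y<L) (occurrences-allSeqs n ys ys<L) ⟩
  1 * (if length ys ≡ᵇ n then 1 else 0)
    ≡⟨ *-identityˡ _ ⟩
  (if length ys ≡ᵇ n then 1 else 0)
    ∎
  where open ≡-Reasoning

growHead : List ℕ → List ℕ
growHead []      = []
growHead (a ∷ c) = suc a ∷ c

extensions : List ℕ → List (List ℕ)
extensions c = (1 ∷ c) ∷ growHead c ∷ []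

-- The recursion defining compositions, with its local incrHead replaced by growHead.
compositions-suc : ∀ n → compositions (2 + n) ≡ concatMap extensions (compositions (suc n))
compositions-suc n = concatMap-cong (λ { [] → refl ; (_ ∷ _) → refl }) (compositions (suc n))

IsComposition : ℕ → List ℕ → Set
IsComposition n c = All (1 ≤_) c × sum c ≡ n

compositions-sound : ∀ n → All (IsComposition n) (compositions n)
compositions-sound zero          = ([] , refl) ∷ []
compositions-sound (suc zero)    = ((s≤s z≤n ∷ []) , refl) ∷ []
compositions-sound (suc (suc n)) =
  subst (All _) (sym (compositions-suc n)) (concat⁺ (map⁺ (All.map extensions-sound (compositions-sound (suc n)))))
  where
  extensions-sound : ∀ {c} → IsComposition (suc n) c → All (IsComposition (2 + n)) (extensions c)
  extensions-sound {[]}    (_ , ())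
  extensions-sound {a ∷ c} (pa ∷ pc , s) =
    (s≤s z≤n ∷ pa ∷ pc , cong suc s) ∷ (s≤s z≤n ∷ pc , cong suc s) ∷ []

occurrences-1∷-extensions : ∀ γ cs → All (All (1 ≤_)) cs →
                            occurrences _≟ₗ_ (1 ∷ γ) (concatMap extensions cs) ≡ occurrences _≟ₗ_ γ cs
occurrences-1∷-extensions γ [] [] = refl
occurrences-1∷-extensions γ ([] ∷ cs) (_ ∷ pcs) with γ ≟ₗ []
... | yes _ = cong suc (occurrences-1∷-extensions γ cs pcs)
... | no  _ = occurrences-1∷-extensions γ cs pcs
occurrences-1∷-extensions γ ((zero ∷ c) ∷ cs) ((() ∷ _) ∷ _)
occurrences-1∷-extensions γ ((suc a ∷ c) ∷ cs) (_ ∷ pcs) with γ ≟ₗ (suc a ∷ c)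
... | yes _ = cong suc (occurrences-1∷-extensions γ cs pcs)
... | no  _ = occurrences-1∷-extensions γ cs pcs

-- Only growHead (b ∷ c) can equal 2 + a ∷ γ, and the test for that computes to
-- the same Boolean as the test of b ∷ c against suc a ∷ γ.
occurrences-2+∷-extensions : ∀ a γ cs →
                             occurrences _≟ₗ_ (2 + a ∷ γ) (concatMap extensions cs)
                               ≡ occurrences _≟ₗ_ (suc a ∷ γ) cs
occurrences-2+∷-extensions a γ []             = refl
occurrences-2+∷-extensions a γ ([] ∷ cs)      = occurrences-2+∷-extensions a γ cs
occurrences-2+∷-extensions a γ ((b ∷ c) ∷ cs) with does ((suc a ∷ γ) ≟ₗ (b ∷ c))
... | true  = cong suc (occurrences-2+∷-extensions a γ cs)
... | false = occurrences-2+∷-extensions a γ cs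

occurrences-compositions-∷ : ∀ a γ → All (1 ≤_) γ →
                             occurrences _≟ₗ_ (suc a ∷ γ) (compositions (suc a + sum γ)) ≡ 1
occurrences-compositions-∷ zero    []          _        = refl
occurrences-compositions-∷ zero    (zero ∷ γ)  (() ∷ _)
occurrences-compositions-∷ zero    (suc b ∷ γ) (_ ∷ pγ) = begin
  occurrences _≟ₗ_ (1 ∷ suc b ∷ γ) (compositions (2 + (b + sum γ)))
    ≡⟨ cong (occurrences _≟ₗ_ (1 ∷ suc b ∷ γ)) (compositions-suc (b + sum γ)) ⟩
  occurrences _≟ₗ_ (1 ∷ suc b ∷ γ) (concatMap extensions (compositions (suc b + sum γ)))
    ≡⟨ occurrences-1∷-extensions (suc b ∷ γ) _ (All.map proj₁ (compositions-sound (suc b + sum γ))) ⟩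
  occurrences _≟ₗ_ (suc b ∷ γ) (compositions (suc b + sum γ))
    ≡⟨ occurrences-compositions-∷ b γ pγ ⟩
  1 ∎
  where open ≡-Reasoning
occurrences-compositions-∷ (suc a) γ pγ = begin
  occurrences _≟ₗ_ (2 + a ∷ γ) (compositions (2 + (a + sum γ)))
    ≡⟨ cong (occurrences _≟ₗ_ (2 + a ∷ γ)) (compositions-suc (a + sum γ)) ⟩
  occurrences _≟ₗ_ (2 + a ∷ γ) (concatMap extensions (compositions (suc a + sum γ)))
    ≡⟨ occurrences-2+∷-extensions a γ (compositions (suc a + sum γ)) ⟩
  occurrences _≟ₗ_ (suc a ∷ γ) (compositions (suc a + sum γ))
    ≡⟨ occurrences-compositions-∷ a γ pγ ⟩
  1 ∎
  where open ≡-Reasoning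

occurrences-compositions : ∀ n {γ} → All (1 ≤_) γ →
                           occurrences _≟ₗ_ γ (compositions n) ≡ (if sum γ ≡ᵇ n then 1 else 0)
occurrences-compositions n {γ} pγ with sum γ ≟ n
... | yes refl rewrite ≡ᵇ-refl (sum γ) = in-degree γ pγ
  where
  in-degree : ∀ γ → All (1 ≤_) γ → occurrences _≟ₗ_ γ (compositions (sum γ)) ≡ 1
  in-degree []          _        = refl
  in-degree (zero ∷ γ)  (() ∷ _)
  in-degree (suc a ∷ γ) (_ ∷ pγ) = occurrences-compositions-∷ a γ pγ
... | no sum≢n rewrite ≢⇒≡ᵇ-false sum≢n =
  occurrences-none _≟ₗ_ (All.map (λ (_ , sum≡n) γ≡c → sum≢n (trans (cong sum γ≡c) sum≡n))
                                 (compositions-sound n))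

factorsFrom : ℕ → List ℕ → List (ℕ × ℕ)
factorsFrom b []          = []
factorsFrom b (zero ∷ e)  = factorsFrom (suc b) e
factorsFrom b (suc c ∷ e) = (b , suc c) ∷ factorsFrom (suc b) e

factors : List ℕ → List (ℕ × ℕ)
factors = factorsFrom 0

variables exponents : List (ℕ × ℕ) → List ℕ
variables ps = proj₁ (unzip ps)
exponents ps = proj₂ (unzip ps)

data Canonical : List (ℕ × ℕ) → Set where
  []  : Canonical []
  _∷_ : ∀ {v c ps} → All ((v <_) ∘ proj₁) ps → Canonical ps → Canonical ((v , suc c) ∷ ps)

factorsFrom-≥ : ∀ b e → All ((b ≤_) ∘ proj₁) (factorsFrom b e)
factorsFrom-≥ b []          = []
factorsFrom-≥ b (zero ∷ e)  = All.map (≤-trans (n≤1+n b)) (factorsFrom-≥ (suc b) e)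
factorsFrom-≥ b (suc c ∷ e) = ≤-refl ∷ All.map (≤-trans (n≤1+n b)) (factorsFrom-≥ (suc b) e)

factorsFrom-< : ∀ b e → All ((_< b + length e) ∘ proj₁) (factorsFrom b e)
factorsFrom-< b []          = []
factorsFrom-< b (zero ∷ e)  rewrite +-suc b (length e) = factorsFrom-< (suc b) e
factorsFrom-< b (suc c ∷ e) rewrite +-suc b (length e) = s≤s (m≤m+n b (length e)) ∷ factorsFrom-< (suc b) e

canonical-factorsFrom : ∀ b e → Canonical (factorsFrom b e)
canonical-factorsFrom b []          = []
canonical-factorsFrom b (zero ∷ e)  = canonical-factorsFrom (suc b) e
canonical-factorsFrom b (suc c ∷ e) = factorsFrom-≥ (suc b) e ∷ canonical-factorsFrom (suc b) e

canonical-factors : ∀ e → Canonical (factors e)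
canonical-factors = canonical-factorsFrom 0

exponents-positive : ∀ {ps} → Canonical ps → All (1 ≤_) (exponents ps)
exponents-positive []        = []
exponents-positive (_ ∷ cps) = s≤s z≤n ∷ exponents-positive cps

strictInc-variables : ∀ {ps} → Canonical ps → T (strictInc (variables ps))
strictInc-variables []                          = _
strictInc-variables (_ ∷ [])                    = _
strictInc-variables ((v<v′ ∷ _) ∷ cps@(_ ∷ _)) = from T-∧ (<⇒<ᵇ v<v′ , strictInc-variables cps)

All-variables : ∀ {P : ℕ → Set} {ps : List (ℕ × ℕ)} → All (P ∘ proj₁) ps → All P (variables ps)
All-variables     []        = []
All-variables {P} (p ∷ pps) = p ∷ All-variables {P} pps

sum-exponents-factorsFrom : ∀ b e → sum (exponents (factorsFrom b e)) ≡ sum e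
sum-exponents-factorsFrom b []          = refl
sum-exponents-factorsFrom b (zero ∷ e)  = sum-exponents-factorsFrom (suc b) e
sum-exponents-factorsFrom b (suc c ∷ e) = cong (suc c +_) (sum-exponents-factorsFrom (suc b) e)

data VanishesBelow : ℕ → List ℕ → Set where
  below-0  : ∀ {v} → VanishesBelow 0 v
  below-[] : ∀ {k} → VanishesBelow k []
  below-∷  : ∀ {k v} → VanishesBelow k v → VanishesBelow (suc k) (0 ∷ v)

vanishesBelow-addAt : ∀ {k i c v} → k ≤ i → VanishesBelow k v → VanishesBelow k (addAt i c v)
vanishesBelow-addAt z≤n       _           = below-0
vanishesBelow-addAt (s≤s k≤i) below-[]    = below-∷ (vanishesBelow-addAt k≤i below-[])
vanishesBelow-addAt (s≤s k≤i) (below-∷ p) = below-∷ (vanishesBelow-addAt k≤i p)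

vanishesBelow-monoOf : ∀ {k ps} → All ((k ≤_) ∘ proj₁) ps → VanishesBelow k (monoOf ps)
vanishesBelow-monoOf []           = below-[]
vanishesBelow-monoOf (k≤i ∷ k≤ps) = vanishesBelow-addAt k≤i (vanishesBelow-monoOf k≤ps)

factorsFrom-addAt : ∀ b j c {v} → VanishesBelow (suc j) v →
                    factorsFrom b (addAt j (suc c) v) ≡ (b + j , suc c) ∷ factorsFrom b v
factorsFrom-addAt b zero    c below-[]    rewrite +-identityʳ b = refl
factorsFrom-addAt b zero    c (below-∷ _) rewrite +-identityʳ b = refl
factorsFrom-addAt b (suc j) c below-[]    rewrite +-suc b j = factorsFrom-addAt (suc b) j c below-[]
factorsFrom-addAt b (suc j) c (below-∷ p) rewrite +-suc b j = factorsFrom-addAt (suc b) j c p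

factors-monoOf : ∀ {ps} → Canonical ps → factors (monoOf ps) ≡ ps
factors-monoOf [] = refl
factors-monoOf {(v , suc c) ∷ ps} (v<ps ∷ cps) =
  trans (factorsFrom-addAt 0 v c (vanishesBelow-monoOf v<ps)) (cong ((v , suc c) ∷_) (factors-monoOf cps))

pad : ℕ → List ℕ → List ℕ
pad b []        = []
pad b s@(_ ∷ _) = replicate b 0 ++ s

replicate-++-∷ : ∀ b (x : ℕ) s → replicate b x ++ x ∷ s ≡ x ∷ replicate b x ++ s
replicate-++-∷ zero    x s = refl
replicate-++-∷ (suc b) x s = cong (x ∷_) (replicate-++-∷ b x s)

addAt-[] : ∀ b c → addAt b c [] ≡ replicate b 0 ++ c ∷ []
addAt-[] zero    c = refl
addAt-[] (suc b) c = cong (0 ∷_) (addAt-[] b c)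

addAt-replicate : ∀ b c y s → addAt b c (replicate b 0 ++ y ∷ s) ≡ replicate b 0 ++ (y + c) ∷ s
addAt-replicate zero    c y s = refl
addAt-replicate (suc b) c y s = cong (0 ∷_) (addAt-replicate b c y s)

monoOf-factorsFrom : ∀ b e → monoOf (factorsFrom b e) ≡ pad b (stripZ e)
monoOf-factorsFrom b []      = refl
monoOf-factorsFrom b (x ∷ e) with stripZ e | monoOf-factorsFrom (suc b) e
monoOf-factorsFrom b (zero ∷ e)  | []    | ih = ih
monoOf-factorsFrom b (zero ∷ e)  | y ∷ s | ih = trans ih (sym (replicate-++-∷ b 0 (y ∷ s)))
monoOf-factorsFrom b (suc c ∷ e) | []    | ih = trans (cong (addAt b (suc c)) ih) (addAt-[] b (suc c))
monoOf-factorsFrom b (suc c ∷ e) | y ∷ s | ih =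
  trans (cong (addAt b (suc c)) (trans ih (sym (replicate-++-∷ b 0 (y ∷ s)))))
        (addAt-replicate b (suc c) 0 (y ∷ s))

monoOf-factors : ∀ e → monoOf (factors e) ≡ stripZ e
monoOf-factors e with stripZ e | monoOf-factorsFrom 0 e
... | []    | eq = eq
... | _ ∷ _ | eq = eq

sameMono⇒factors≡ : ∀ x y → T (sameMono x y) → factors x ≡ factors y
sameMono⇒factors≡ x y same = begin
  factors x                     ≡⟨ factors-monoOf (canonical-factors x) ⟨
  factors (monoOf (factors x))  ≡⟨ cong factors (monoOf-factors x) ⟩
  factors (stripZ x)            ≡⟨ cong factors (eqList⇒≡ (stripZ x) (stripZ y) same) ⟩
  factors (stripZ y)            ≡⟨ cong factors (monoOf-factors y) ⟨
  factors (monoOf (factors y))  ≡⟨ factors-monoOf (canonical-factors y) ⟩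
  factors y                     ∎
  where open ≡-Reasoning

factors≡⇒sameMono : ∀ x y → factors x ≡ factors y → T (sameMono x y)
factors≡⇒sameMono x y eq = subst (T ∘ eqList (stripZ x)) stripZ-eq (eqList-refl (stripZ x))
  where
  stripZ-eq : stripZ x ≡ stripZ y
  stripZ-eq = trans (sym (monoOf-factors x)) (trans (cong monoOf eq) (monoOf-factors y))

All-zip : ∀ {P : ℕ → Set} {is} (β : List ℕ) → All P is → All (P ∘ proj₁) (zip is β)
All-zip     _       []         = []
All-zip     []      (_ ∷ _)    = []
All-zip {P} (_ ∷ β) (pi ∷ pis) = pi ∷ All-zip {P} β pis

canonical-zip : ∀ is {β} → T (strictInc is) → All (1 ≤_) β → Canonical (zip is β)
canonical-zip []       _      _              = []
canonical-zip (i ∷ is) _      []             = []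
canonical-zip (i ∷ is) sorted (s≤s z≤n ∷ pβ) =
  let i<is , sorted-is = strictInc⁻ {i} {is} sorted in All-zip _ i<is ∷ canonical-zip is sorted-is pβ

sameMono-zip⇒unzip-factors : ∀ {is β} e → length is ≡ length β → T (strictInc is) → All (1 ≤_) β →
                             T (sameMono (monoOf (zip is β)) e) → (is , β) ≡ unzip (factors e)
sameMono-zip⇒unzip-factors {is} {β} e len sorted pβ same =
  trans (sym (unzip-zip is β len)) (cong unzip zip≡factors)
  where
  zip≡factors : zip is β ≡ factors e
  zip≡factors = trans (sym (factors-monoOf (canonical-zip is sorted pβ)))
                      (sameMono⇒factors≡ (monoOf (zip is β)) e same)

expand : List (ℕ × ℕ) → List ℕ
expand []             = []
expand ((v , c) ∷ ps) = replicate c v ++ expand ps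

All-expand : ∀ {P : ℕ → Set} {ps} → All (P ∘ proj₁) ps → All P (expand ps)
All-expand                     []         = []
All-expand {ps = (v , c) ∷ _} (pv ∷ pps) = ++⁺ (replicate⁺ c pv) (All-expand pps)

length-expand : ∀ ps → length (expand ps) ≡ sum (exponents ps)
length-expand []             = refl
length-expand ((v , c) ∷ ps) = trans (length-++ (replicate c v)) (cong₂ _+_ (length-replicate c) (length-expand ps))

weakInc-expand : ∀ {ps} → Canonical ps → T (weakInc (expand ps))
weakInc-expand [] = _
weakInc-expand {(v , suc c) ∷ ps} (v<ps ∷ cps) = block (suc c)
  where
  block : ∀ k → T (weakInc (replicate k v ++ expand ps))
  block zero    = weakInc-expand cps
  block (suc k) = weakInc-∷ (++⁺ (replicate⁺ k ≤-refl) (All-expand (All.map <⇒≤ v<ps))) (block k)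

deduplicate-replicate : ∀ c v R → All (v <_) R →
                        deduplicateᵇ _≡ᵇ_ (replicate (suc c) v ++ R) ≡ v ∷ deduplicateᵇ _≡ᵇ_ R
deduplicate-replicate c v R v<R = cong (v ∷_) (drop-v c)
  where
  v≢? : Decidable (λ x → ¬ T (v ≡ᵇ x))
  v≢? x = ¬? (T? (v ≡ᵇ x))
  drop-v : ∀ k → filter v≢? (deduplicateᵇ _≡ᵇ_ (replicate k v ++ R)) ≡ deduplicateᵇ _≡ᵇ_ R
  drop-v zero    =
    filter-all v≢? (deduplicate⁺ _ (All.map (λ v<x v≡ᵇx → <⇒≢ v<x (≡ᵇ⇒≡ _ _ v≡ᵇx)) v<R))
  drop-v (suc k) rewrite ≡ᵇ-refl v =
    trans (filter-idem v≢? (deduplicateᵇ _≡ᵇ_ (replicate k v ++ R))) (drop-v k)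

distinct-expand : ∀ {ps} → Canonical ps → distinct (expand ps) ≡ length ps
distinct-expand [] = refl
distinct-expand {(v , suc c) ∷ ps} (v<ps ∷ cps) =
  trans (cong length (deduplicate-replicate c v (expand ps) (All-expand v<ps))) (cong suc (distinct-expand cps))

addAt-addAt : ∀ i a b w → addAt i a (addAt i b w) ≡ addAt i (b + a) w
addAt-addAt zero    a b []      = refl
addAt-addAt zero    a b (x ∷ w) = cong (_∷ w) (+-assoc x b a)
addAt-addAt (suc i) a b []      = cong (0 ∷_) (addAt-addAt i a b [])
addAt-addAt (suc i) a b (x ∷ w) = cong (x ∷_) (addAt-addAt i a b w)

monoOfIdx-replicate : ∀ c v R → monoOfIdx (replicate (suc c) v ++ R) ≡ addAt v (suc c) (monoOfIdx R)
monoOfIdx-replicate zero    v R = refl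
monoOfIdx-replicate (suc c) v R = begin
  addAt v 1 (monoOfIdx (replicate (suc c) v ++ R))  ≡⟨ cong (addAt v 1) (monoOfIdx-replicate c v R) ⟩
  addAt v 1 (addAt v (suc c) (monoOfIdx R))          ≡⟨ addAt-addAt v 1 (suc c) (monoOfIdx R) ⟩
  addAt v (suc c + 1) (monoOfIdx R)                  ≡⟨ cong (λ k → addAt v k (monoOfIdx R)) (+-comm (suc c) 1) ⟩
  addAt v (2 + c) (monoOfIdx R)                      ∎
  where open ≡-Reasoning

monoOfIdx-expand : ∀ {ps} → Canonical ps → monoOfIdx (expand ps) ≡ monoOf ps
monoOfIdx-expand [] = refl
monoOfIdx-expand {(v , suc c) ∷ ps} (_ ∷ cps) =
  trans (monoOfIdx-replicate c v (expand ps)) (cong (addAt v (suc c)) (monoOfIdx-expand cps))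

expand-factorsFrom-addAt : ∀ b j {v} → VanishesBelow j v →
                           expand (factorsFrom b (addAt j 1 v)) ≡ (b + j) ∷ expand (factorsFrom b v)
expand-factorsFrom-addAt b zero    {[]}        _ rewrite +-identityʳ b = refl
expand-factorsFrom-addAt b zero    {zero ∷ v}  _ rewrite +-identityʳ b = refl
expand-factorsFrom-addAt b zero    {suc x ∷ v} _ rewrite +-identityʳ b | +-comm x 1 = refl
expand-factorsFrom-addAt b (suc j) below-[]    rewrite +-suc b j = expand-factorsFrom-addAt (suc b) j below-[]
expand-factorsFrom-addAt b (suc j) (below-∷ p) rewrite +-suc b j = expand-factorsFrom-addAt (suc b) j p

expand-factors-monoOfIdx : ∀ J → T (weakInc J) → expand (factors (monoOfIdx J)) ≡ J
expand-factors-monoOfIdx []      _      = refl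
expand-factors-monoOfIdx (j ∷ J) sorted =
  let j≤J , sorted-J = weakInc⁻ {j} {J} sorted
  in trans (expand-factorsFrom-addAt 0 j (vanishesBelow-monoOf (map⁺ j≤J)))
           (cong (j ∷_) (expand-factors-monoOfIdx J sorted-J))

-- 0-based: compares j_t with j_{t+1}, whereas triple counts positions from 1.
adjacentEqual : List ℕ → ℕ → Bool
adjacentEqual (x ∷ J)     (suc t) = adjacentEqual J t
adjacentEqual (x ∷ y ∷ J) zero    = x ≡ᵇ y
adjacentEqual _           _       = false

triple≡adjacentEqual∧ : ∀ J m → triple J (2 + m) ≡ adjacentEqual J m ∧ adjacentEqual J (suc m)
triple≡adjacentEqual∧ []              zero    = refl
triple≡adjacentEqual∧ []              (suc m) = refl
triple≡adjacentEqual∧ (x ∷ [])        zero    = refl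
triple≡adjacentEqual∧ (x ∷ y ∷ [])    zero    = sym (∧-zeroʳ (x ≡ᵇ y))
triple≡adjacentEqual∧ (x ∷ y ∷ z ∷ J) zero    = refl
triple≡adjacentEqual∧ (x ∷ J)         (suc m) = triple≡adjacentEqual∧ J m

memb-map-suc : ∀ k X → memb (suc k) (map suc X) ≡ memb k X
memb-map-suc k []      = refl
memb-map-suc k (x ∷ X) = cong ((k ≡ᵇ x) ∨_) (memb-map-suc k X)

memb-0-map-suc : ∀ X → memb 0 (map suc X) ≡ false
memb-0-map-suc []      = refl
memb-0-map-suc (x ∷ X) = memb-0-map-suc X

I-suc : ∀ a γ → I (suc a ∷ γ) ≡ map suc (I (a ∷ γ))
I-suc a []      = refl
I-suc a (b ∷ γ) = cong (suc a ∷_) (map-∘ (I (b ∷ γ)))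

memb-suc-I-suc : ∀ t a γ → memb (suc t) (I (suc a ∷ γ)) ≡ memb t (I (a ∷ γ))
memb-suc-I-suc t a γ = trans (cong (memb (suc t)) (I-suc a γ)) (memb-map-suc t (I (a ∷ γ)))

memb-0-I-suc : ∀ a γ → memb 0 (I (suc a ∷ γ)) ≡ false
memb-0-I-suc a γ = trans (cong (memb 0) (I-suc a γ)) (memb-0-map-suc (I (a ∷ γ)))

adjacentEqual-block : ∀ v c ps → All ((v <_) ∘ proj₁) ps → Canonical ps →
                      ∀ t → suc t < length (expand ((v , suc c) ∷ ps)) →
                      adjacentEqual (expand ((v , suc c) ∷ ps)) t ≡ not (memb (suc t) (I (suc c ∷ exponents ps)))
adjacentEqual-block v (suc c) ps _ _ zero _ =
  trans (≡ᵇ-refl v)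
        (cong not (sym (trans (memb-suc-I-suc 0 (suc c) (exponents ps)) (memb-0-I-suc c (exponents ps)))))
adjacentEqual-block v (suc c) ps v<ps cps (suc t) (s≤s t<) =
  trans (adjacentEqual-block v c ps v<ps cps t t<) (cong not (sym (memb-suc-I-suc (suc t) (suc c) (exponents ps))))
adjacentEqual-block v zero [] _ _ t (s≤s ())
adjacentEqual-block v zero ((v′ , suc c′) ∷ ps) (v<v′ ∷ _) _ zero _ = ≢⇒≡ᵇ-false (<⇒≢ v<v′)
adjacentEqual-block v zero ((v′ , suc c′) ∷ ps) _ (v′<ps ∷ cps) (suc t) (s≤s t<) =
  trans (adjacentEqual-block v′ c′ ps v′<ps cps t t<)
        (cong not (sym (memb-map-suc (suc t) (I (suc c′ ∷ exponents ps)))))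

adjacentEqual-expand : ∀ {ps} → Canonical ps → ∀ t → suc t < length (expand ps) →
                       adjacentEqual (expand ps) t ≡ not (memb (suc t) (I (exponents ps)))
adjacentEqual-expand {(v , suc c) ∷ ps} (v<ps ∷ cps) = adjacentEqual-block v c ps v<ps cps

not-triple-expand : ∀ {ps} → Canonical ps → ∀ m → 2 + m < length (expand ps) →
                    not (triple (expand ps) (2 + m))
                      ≡ (memb (2 + m) (I (exponents ps)) ∨ memb (2 + m) (map suc (I (exponents ps))))
not-triple-expand {ps} cps m 2+m< = begin
  not (triple J (2 + m))                             ≡⟨ cong not (triple≡adjacentEqual∧ J m) ⟩
  not (adjacentEqual J m ∧ adjacentEqual J (suc m))  ≡⟨ cong not (cong₂ _∧_ descent-m descent-1+m) ⟩
  not (not a ∧ not b)                                ≡⟨ cong not (deMorgan₂ a b) ⟨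
  not (not (a ∨ b))                                  ≡⟨ not-involutive (a ∨ b) ⟩
  a ∨ b                                              ≡⟨ ∨-comm a b ⟩
  b ∨ a                                              ≡⟨ cong (b ∨_) (memb-map-suc (suc m) (I (exponents ps))) ⟨
  b ∨ memb (2 + m) (map suc (I (exponents ps)))      ∎
  where
  open ≡-Reasoning
  J : List ℕ
  J = expand ps
  a b : Bool
  a = memb (suc m) (I (exponents ps))
  b = memb (2 + m) (I (exponents ps))
  descent-m : adjacentEqual J m ≡ not a
  descent-m = adjacentEqual-expand cps m (<-trans (n<1+n _) 2+m<)
  descent-1+m : adjacentEqual J (suc m) ≡ not b
  descent-1+m = adjacentEqual-expand cps (suc m) 2+m<

inA-expand : ∀ α {ps} → Canonical ps → All (λ i → 2 ≤ i × i < length (expand ps)) (I α) →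
             inA α (expand ps) ≡ containCond α (exponents ps)
inA-expand α {ps} cps inner = not-any inner not-triple
  where
  not-triple : ∀ {i} → 2 ≤ i × i < length (expand ps) →
               not (triple (expand ps) i) ≡ (memb i (I (exponents ps)) ∨ memb i (map suc (I (exponents ps))))
  not-triple {suc zero}    (s≤s () , _)
  not-triple {suc (suc m)} (_ , i<) = not-triple-expand cps m i<

I-bounds : ∀ a r → All (1 ≤_) r → All (λ i → a ≤ i × i < sum (a ∷ r)) (I (a ∷ r))
I-bounds a []      _          = []
I-bounds a (b ∷ r) (1≤b ∷ pr) =
  (≤-refl , m<m+n a (≤-trans 1≤b (m≤m+n b (sum r))))
  ∷ map⁺ (All.map (λ (_ , i<) → m≤m+n a _ , +-monoʳ-< a i<) (I-bounds b r pr))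

I-bounds-2-n : ∀ {n} α → All (1 ≤_) α → sum α ≡ n →
               (n ≤ 1 ⊎ Σ ℕ (λ a → Σ (List ℕ) (λ r → α ≡ a ∷ r × 1 < a))) →
               All (λ i → 2 ≤ i × i < n) (I α)
I-bounds-2-n []          _               _    _          = []
I-bounds-2-n (a ∷ [])    _               _    _          = []
I-bounds-2-n (a ∷ b ∷ r) (1≤a ∷ 1≤b ∷ _) refl (inj₁ n≤1) =
  contradiction (≤-trans (+-mono-≤ 1≤a (≤-trans 1≤b (m≤m+n b (sum r)))) n≤1) 1+n≰n
I-bounds-2-n (a ∷ b ∷ r) (_ ∷ pr) sα (inj₂ (_ , _ , refl , 1<a)) =
  All.map (λ (a≤i , i<) → ≤-trans 1<a a≤i , subst (_ <_) sα i<) (I-bounds a (b ∷ r) pr)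

-- For x^e: the indices of its variables, the composition of its nonzero
-- exponents, and the weakly increasing J with x_J = x^e.
support shape indexSeq : List ℕ → List ℕ
support  e = variables (factors e)
shape    e = exponents (factors e)
indexSeq e = expand (factors e)

length-indexSeq : ∀ e → length (indexSeq e) ≡ sum e
length-indexSeq e = trans (length-expand (factors e)) (sum-exponents-factorsFrom 0 e)

weakInc-sameMono⇒indexSeq : ∀ {J} e → T (weakInc J) → T (sameMono (monoOfIdx J) e) → J ≡ indexSeq e
weakInc-sameMono⇒indexSeq {J} e sorted same =
  trans (sym (expand-factors-monoOfIdx J sorted)) (cong expand (sameMono⇒factors≡ (monoOfIdx J) e same))

sameMono-indexSeq : ∀ e → sameMono (monoOfIdx (indexSeq e)) e ≡ true
sameMono-indexSeq e = to T-≡ (factors≡⇒sameMono (monoOfIdx (indexSeq e)) e factors-eq)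
  where
  factors-eq : factors (monoOfIdx (indexSeq e)) ≡ factors e
  factors-eq = trans (cong factors (monoOfIdx-expand (canonical-factors e))) (factors-monoOf (canonical-factors e))

inA-indexSeq : ∀ {n} α e → sum e ≡ n → All (λ i → 2 ≤ i × i < n) (I α) →
               inA α (indexSeq e) ≡ containCond α (shape e)
inA-indexSeq α e sum≡n inner =
  inA-expand α (canonical-factors e)
             (subst (λ m → All (λ i → 2 ≤ i × i < m) (I α)) (sym (trans (length-indexSeq e) sum≡n)) inner)

coeffM-≢shape : ∀ {β} e → All (1 ≤_) β → β ≢ shape e → coeffM β e ≡ 0
coeffM-≢shape {β} e pβ β≢shape = cong length (filter-none (T? ∘ same) (All.tabulate not-same))
  where
  same : List ℕ → Bool
  same is = sameMono (monoOf (zip is β)) e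
  not-same : ∀ {is} → is ∈ filterᵇ strictInc (allSeqs (length β) (length e)) → ¬ T (same is)
  not-same {is} is∈ s =
    let is∈S , sorted = ∈-filter⁻ (T? ∘ strictInc) is∈
        len = All.lookup (allSeqs-length _ _) is∈S
    in β≢shape (cong proj₂ (sameMono-zip⇒unzip-factors {is} e len sorted pβ s))

coeffM-shape : ∀ e → coeffM (shape e) e ≡ 1
coeffM-shape e = begin
  length (filterᵇ same (filterᵇ strictInc S))
    ≡⟨ length-filter-concentrated _≟ₗ_ (T? ∘ same) (filterᵇ strictInc S) only-support same-support ⟩
  occurrences _≟ₗ_ (support e) (filterᵇ strictInc S)
    ≡⟨ occurrences-filter _≟ₗ_ (T? ∘ strictInc) S (strictInc-variables (canonical-factors e)) ⟩
  occurrences _≟ₗ_ (support e) S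
    ≡⟨ occurrences-allSeqs (length (shape e)) (support e) (All-variables (factorsFrom-< 0 e)) ⟩
  (if length (support e) ≡ᵇ length (shape e) then 1 else 0)
    ≡⟨ cong (λ m → if m ≡ᵇ length (shape e) then 1 else 0) same-length ⟩
  (if length (shape e) ≡ᵇ length (shape e) then 1 else 0)
    ≡⟨ cong (λ b → if b then 1 else 0) (≡ᵇ-refl (length (shape e))) ⟩
  1 ∎
  where
  open ≡-Reasoning
  S : List (List ℕ)
  S = allSeqs (length (shape e)) (length e)
  same : List ℕ → Bool
  same is = sameMono (monoOf (zip is (shape e))) e
  same-length : length (support e) ≡ length (shape e)
  same-length = trans (length-unzipWith₁ id (factors e)) (sym (length-unzipWith₂ id (factors e)))
  only-support : ∀ {is} → is ∈ filterᵇ strictInc S → T (same is) → is ≡ support e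
  only-support {is} is∈ s =
    let is∈S , sorted = ∈-filter⁻ (T? ∘ strictInc) is∈
    in cong proj₁ (sameMono-zip⇒unzip-factors {is} e (All.lookup (allSeqs-length _ _) is∈S) sorted
                                                   (exponents-positive (canonical-factors e)) s)
  same-support : T (same (support e))
  same-support = factors≡⇒sameMono (monoOf (zip (support e) (shape e))) e
                                   (trans (cong (factors ∘ monoOf) (zip-unzip (factors e))) (factors-monoOf (canonical-factors e)))

coeffθ-formula : ∀ n α e →
                 coeffθ n α e ≡ (if (sum e ≡ᵇ n) ∧ containCond α (shape e) then 2 ^ length (shape e) else 0)
coeffθ-formula n α e = begin
  sum (map term (compositions n))
    ≡⟨ sum-map-concentrated _≟ₗ_ term (shape e) (compositions n) term-vanishes ⟩
  occurrences _≟ₗ_ (shape e) (compositions n) * term (shape e)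
    ≡⟨ cong₂ _*_ (occurrences-compositions n (exponents-positive (canonical-factors e))) term-shape ⟩
  (if sum (shape e) ≡ᵇ n then 1 else 0) * (if containCond α (shape e) then 2 ^ length (shape e) else 0)
    ≡⟨ indicator-* (sum (shape e) ≡ᵇ n) (containCond α (shape e)) (2 ^ length (shape e)) ⟩
  (if (sum (shape e) ≡ᵇ n) ∧ containCond α (shape e) then 2 ^ length (shape e) else 0)
    ≡⟨ cong (λ s → if (s ≡ᵇ n) ∧ containCond α (shape e) then 2 ^ length (shape e) else 0)
            (sum-exponents-factorsFrom 0 e) ⟩
  (if (sum e ≡ᵇ n) ∧ containCond α (shape e) then 2 ^ length (shape e) else 0) ∎
  where
  open ≡-Reasoning
  term : List ℕ → ℕ
  term β = if containCond α β then 2 ^ length β * coeffM β e else 0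
  term-vanishes : ∀ {β} → β ∈ compositions n → β ≢ shape e → term β ≡ 0
  term-vanishes {β} β∈ β≢ with containCond α β
  ... | false = refl
  ... | true  = let pβ = proj₁ (All.lookup (compositions-sound n) β∈)
                in trans (cong (2 ^ length β *_) (coeffM-≢shape e pβ β≢)) (*-zeroʳ (2 ^ length β))
  term-shape : term (shape e) ≡ (if containCond α (shape e) then 2 ^ length (shape e) else 0)
  term-shape = cong (λ m → if containCond α (shape e) then m else 0)
                    (trans (cong (2 ^ length (shape e) *_) (coeffM-shape e)) (*-identityʳ _))

coeffBH-formula : ∀ n α e →
                  coeffBH n α e ≡ (if (sum e ≡ᵇ n) ∧ inA α (indexSeq e) then 2 ^ length (shape e) else 0)
coeffBH-formula n α e = begin
  sum (map term (filterᵇ weakInc S))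
    ≡⟨ sum-map-concentrated _≟ₗ_ term (indexSeq e) (filterᵇ weakInc S) term-vanishes ⟩
  occurrences _≟ₗ_ (indexSeq e) (filterᵇ weakInc S) * term (indexSeq e)
    ≡⟨ cong₂ _*_ occurrences-indexSeq term-indexSeq ⟩
  (if length (indexSeq e) ≡ᵇ n then 1 else 0) * (if inA α (indexSeq e) then 2 ^ length (shape e) else 0)
    ≡⟨ indicator-* (length (indexSeq e) ≡ᵇ n) (inA α (indexSeq e)) (2 ^ length (shape e)) ⟩
  (if (length (indexSeq e) ≡ᵇ n) ∧ inA α (indexSeq e) then 2 ^ length (shape e) else 0)
    ≡⟨ cong (λ s → if (s ≡ᵇ n) ∧ inA α (indexSeq e) then 2 ^ length (shape e) else 0) (length-indexSeq e) ⟩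
  (if (sum e ≡ᵇ n) ∧ inA α (indexSeq e) then 2 ^ length (shape e) else 0) ∎
  where
  open ≡-Reasoning
  S : List (List ℕ)
  S = allSeqs n (length e)
  term : List ℕ → ℕ
  term J = if inA α J ∧ sameMono (monoOfIdx J) e then 2 ^ distinct J else 0
  term-vanishes : ∀ {J} → J ∈ filterᵇ weakInc S → J ≢ indexSeq e → term J ≡ 0
  term-vanishes {J} J∈ J≢ with inA α J ∧ sameMono (monoOfIdx J) e in chosen
  ... | false = refl
  ... | true  = contradiction (weakInc-sameMono⇒indexSeq e (proj₂ (∈-filter⁻ (T? ∘ weakInc) {xs = S} J∈))
                                                            (proj₂ (to T-∧ (from T-≡ chosen)))) J≢
  occurrences-indexSeq : occurrences _≟ₗ_ (indexSeq e) (filterᵇ weakInc S)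
                           ≡ (if length (indexSeq e) ≡ᵇ n then 1 else 0)
  occurrences-indexSeq = trans (occurrences-filter _≟ₗ_ (T? ∘ weakInc) S (weakInc-expand (canonical-factors e)))
                               (occurrences-allSeqs n (indexSeq e) (All-expand (factorsFrom-< 0 e)))
  term-indexSeq : term (indexSeq e) ≡ (if inA α (indexSeq e) then 2 ^ length (shape e) else 0)
  term-indexSeq = cong₂ (λ b k → if b then 2 ^ k else 0)
                        (trans (cong (inA α (indexSeq e) ∧_) (sameMono-indexSeq e)) (∧-identityʳ _))
                        (trans (distinct-expand (canonical-factors e)) (sym (length-unzipWith₂ id (factors e))))

theorem3p5 : (n : ℕ) (α : List ℕ) → All (λ a → 1 ≤ a) α → sum α ≡ n →
             (n ≤ 1 ⊎ Σ ℕ (λ a → Σ (List ℕ) (λ r → α ≡ a ∷ r × 1 < a))) →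
             (e : List ℕ) → coeffθ n α e ≡ coeffBH n α e
theorem3p5 n α pos sα hyp e = begin
  coeffθ n α e                                     ≡⟨ coeffθ-formula n α e ⟩
  weight ((sum e ≡ᵇ n) ∧ containCond α (shape e))  ≡⟨ cong weight (∧-cong-T (sum e ≡ᵇ n) in-degree) ⟩
  weight ((sum e ≡ᵇ n) ∧ inA α (indexSeq e))       ≡⟨ coeffBH-formula n α e ⟨
  coeffBH n α e                                    ∎
  where
  open ≡-Reasoning
  weight : Bool → ℕ
  weight b = if b then 2 ^ length (shape e) else 0
  in-degree : T (sum e ≡ᵇ n) → containCond α (shape e) ≡ inA α (indexSeq e)
  in-degree sum≡ᵇn = sym (inA-indexSeq α e (≡ᵇ⇒≡ _ _ sum≡ᵇn) (I-bounds-2-n α pos sα hyp))
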